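{- For every $\varepsilon>0$ there exists $N$ such that for all integers $n\ge N$, \[\max_{\alpha\in\mathbb{Z}^{+}}\big|\mathcal{T}(\alpha,[n])\big| < n^{\frac{(1+\varepsilon)\log n}{\log\log n}}.\]
   Context: $[n]=\{1,\dots,n\}$ and $\log=\log_2$. For finite $A,B\subset\mathbb{Z}^d$, $A+B=\{a+b:a\in A,b\in B\}$. For a finite $C\subset\mathbb{Z}^d$ and $\alpha\in\mathbb{Z}^+$, $\mathcal{T}(\alpha,C)$ is the set of pairs $(A,B)$ of finite subsets of $\mathbb{Z}^d$ such that $A+B=C$, $|C|=|A|\cdot|B|$, $|A|=\alpha$, and $(A,B)$ is in canonical form: $(0,\dots,0)\in B$ and every coordinate of every element of $B$ is $\ge 0$.
   Formalization: The parameter ε ranges over the positive rationals. -}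

module Defs where

open import Data.Nat as ℕ using (ℕ; _^_; _≥_)
open import Data.Integer as ℤ using (ℤ; +_)
open import Data.List using (List; length)
open import Data.List.Membership.Propositional using (_∈_)
open import Data.List.Relation.Unary.All using (All)
open import Data.List.Relation.Unary.AllPairs using (AllPairs)
open import Data.List.Relation.Unary.Unique.Propositional using (Unique)
open import Data.Product using (Σ; ∃; _×_; proj₁; proj₂)
open import Relation.Binary.PropositionalEquality using (_≡_)
open import Relation.Nullary using (¬_)

-- A finite subset of ℤ is represented by a duplicate-free list; its
-- cardinality is then the length of the list.
FinSubset : Set
FinSubset = List ℤ

SameSet : FinSubset → FinSubset → Set
SameSet X Y = ∀ z → (z ∈ X → z ∈ Y) × (z ∈ Y → z ∈ X)

In[_] : ℕ → ℤ → Set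
In[ n ] z = (+ 1 ℤ.≤ z) × (z ℤ.≤ + n)

SumsetIs[_] : ℕ → FinSubset → FinSubset → Set
SumsetIs[ n ] A B =
  ∀ z → (In[ n ] z → ∃ λ a → ∃ λ b → a ∈ A × b ∈ B × z ≡ a ℤ.+ b)
      × (∀ a b → a ∈ A → b ∈ B → z ≡ a ℤ.+ b → In[ n ] z)

-- (A , B) ∈ 𝒯(α, [n])  (here d = 1, since C = [n] ⊂ ℤ)
InT : ℕ → ℕ → FinSubset × FinSubset → Set
InT α n (A Data.Product., B) =
  Unique A × Unique B
  × SumsetIs[ n ] A B
  × (n ≡ length A ℕ.* length B)          -- |C| = |A|·|B|, with |[n]| = n
  × (length A ≡ α)
  × ((+ 0) ∈ B)
  × All (λ b → + 0 ℤ.≤ b) B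

DistinctPairs : FinSubset × FinSubset → FinSubset × FinSubset → Set
DistinctPairs P Q = ¬ (SameSet (proj₁ P) (proj₁ Q) × SameSet (proj₂ P) (proj₂ Q))

-- BelowBound p q n K  encodes the real inequality
--     K < n ^ ((1 + p/q) · log n / log log n)      (log = log₂, n ≥ 3),
-- i.e.  log K · log L < (1 + p/q) · L²   with L = log n,
-- via rational witnesses with common denominator D:
--   w₁/D ≤ L ≤ w₂/D,  log K ≤ m/D,  log (w₂/D) ≤ ℓ/D,
--   (m/D)(ℓ/D) < (1 + p/q)(w₁/D)².
-- For n ≥ 3 (so log log n > 0) this is equivalent to the real inequality.
BelowBound : ℕ → ℕ → ℕ → ℕ → Set
BelowBound p q n K =
  Σ ℕ λ D → Σ ℕ λ w₁ → Σ ℕ λ w₂ → Σ ℕ λ m → Σ ℕ λ ℓ →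
    (D ≥ 1)
    × (2 ^ w₁ ℕ.≤ n ^ D)
    × (n ^ D ℕ.≤ 2 ^ w₂)
    × (K ^ D ℕ.≤ 2 ^ m)
    × (w₂ ^ D ℕ.≤ 2 ^ ℓ ℕ.* D ^ D)
    × (q ℕ.* m ℕ.* ℓ ℕ.< (q ℕ.+ p) ℕ.* w₁ ℕ.* w₁)

{-# OPTIONS --safe #-}
module Submission where

-- Let A ⊕ B = {0, …, n − 1} with 0 ∈ A ∩ B and 1 ∈ B, and let k be the least number missing
-- from B. De Bruijn's induction shows that A ⊆ kℕ, that B is a union of whole blocks
-- {jk, …, jk + k − 1}, and that k ∣ n; hence (A / k, (B ∩ kℕ) / k) tiles {0, …, n / k − 1}.
-- Iterating, with A and B swapped whenever 1 ∈ A, a tiling is determined by its sequence of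
-- block lengths and sides. The number D(n) of such sequences satisfies
-- D(n) ≤ 1 + 2 Σ_{k = 2}^{n} D(⌊n / k⌋), hence D(n) ≤ n³ because 2 Σ_{k ≥ 2} 1 / k³ < 1.
-- Every (A, B) ∈ 𝒯(α, [n]) yields the tiling (A − 1, B), so |𝒯(α, [n])| ≤ n³, which is far
-- below n^((1 + ε) log n / log log n) for large n.

open import Defs
open import Level using (0ℓ)
open import Data.Bool using (Bool; true; false)
open import Data.Empty using (⊥-elim)
open import Data.Integer as ℤ using (ℤ)
import Data.Integer.Properties as ℤ
open import Data.List using (List; []; _∷_; _++_; map; length; upTo; cartesianProduct)
open import Data.List.Properties using (length-++; length-map; length-++-sucʳ; length-upTo)
open import Data.List.Membership.Propositional using (_∈_)
open import Data.List.Membership.Propositional.Properties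
  using (∈-++⁺ˡ; ∈-++⁺ʳ; ∈-++⁻; ∈-∃++; ∈-map⁺; ∈-map⁻; ∈-upTo⁻; ∈-cartesianProduct⁺)
open import Data.List.Membership.DecPropositional ℤ._≟_ using (_∈?_)
open import Data.List.Relation.Binary.Subset.Propositional using (_⊆_)
open import Data.List.Relation.Unary.All as All using (All; []; _∷_)
open import Data.List.Relation.Unary.AllPairs using (AllPairs; []; _∷_)
open import Data.List.Relation.Unary.Any using (here; there)
open import Data.List.Relation.Unary.Unique.Propositional using (Unique)
import Data.List.Relation.Unary.Unique.Propositional.Properties as Unique
open import Data.Nat
open import Data.Nat.DivMod
open import Data.Nat.Divisibility
  using (_∣_; divides; ∣m+n∣m⇒∣n; ∣m∣n⇒∣m+n; ∣⇒≤; m%n≡0⇒n∣m)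
open import Data.Nat.Induction using (<-rec)
open import Data.Nat.Properties
open import Data.Nat.Tactic.RingSolver using (solve-∀)
open import Data.Product using (Σ; ∃; ∃₂; _×_; _,_; proj₁; proj₂; uncurry)
open import Data.Sum using (_⊎_; inj₁; inj₂)
open import Function using (_∘_)
open import Function.Bundles using (_⇔_; mk⇔; Equivalence)
open import Relation.Binary.PropositionalEquality
open import Relation.Nullary using (¬_; yes; no)
open import Relation.Unary using (Pred; Decidable; _≐_)

open Equivalence using (to; from)

module _ {X : Set} where

  ∈-insert⁻ : ∀ xs {ys} {x z : X} → z ∈ xs ++ x ∷ ys → z ≡ x ⊎ z ∈ xs ++ ys
  ∈-insert⁻ xs z∈ with ∈-++⁻ xs z∈
  ... | inj₁ z∈xs         = inj₂ (∈-++⁺ˡ z∈xs)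
  ... | inj₂ (here z≡x)   = inj₁ z≡x
  ... | inj₂ (there z∈ys) = inj₂ (∈-++⁺ʳ xs z∈ys)

  unique⇒length≤ : ∀ {xs ys : List X} → Unique xs → xs ⊆ ys → length xs ≤ length ys
  unique⇒length≤ {[]}     _            _       = z≤n
  unique⇒length≤ {x ∷ xs} (x∉xs ∷ xs!) x∷xs⊆ys with ∈-∃++ (x∷xs⊆ys (here refl))
  ... | ys₁ , ys₂ , refl = begin
    suc (length xs)           ≤⟨ s≤s (unique⇒length≤ xs! xs⊆ys₁ys₂) ⟩
    suc (length (ys₁ ++ ys₂)) ≡⟨ length-++-sucʳ ys₁ x ys₂ ⟨
    length (ys₁ ++ x ∷ ys₂)   ∎
    where
    open ≤-Reasoning
    xs⊆ys₁ys₂ : xs ⊆ ys₁ ++ ys₂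
    xs⊆ys₁ys₂ z∈xs with ∈-insert⁻ ys₁ (x∷xs⊆ys (there z∈xs))
    ... | inj₁ refl     = ⊥-elim (All.lookup x∉xs z∈xs refl)
    ... | inj₂ z∈ys₁ys₂ = z∈ys₁ys₂

module _ {X Y : Set} (f : X → Y) where

  pigeonhole : ∀ {xs ys} → Unique ys → ys ⊆ map f xs → length xs ≤ length ys →
               ∀ {x x′} → x ∈ xs → x′ ∈ xs → x ≢ x′ → f x ≢ f x′
  pigeonhole {ys = ys} ys! ys⊆f[xs] |xs|≤|ys| {x} {x′} x∈xs x′∈xs x≢x′ fx≡fx′ with ∈-∃++ x∈xs
  ... | xs₁ , xs₂ , refl = <⇒≱ shorter (unique⇒length≤ ys! ys⊆f[rest])
    where
    open ≤-Reasoning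
    rest = xs₁ ++ xs₂
    x′∈rest : x′ ∈ rest
    x′∈rest with ∈-insert⁻ xs₁ x′∈xs
    ... | inj₁ refl     = ⊥-elim (x≢x′ refl)
    ... | inj₂ x′∈rest = x′∈rest
    ys⊆f[rest] : ys ⊆ map f rest
    ys⊆f[rest] y∈ys with ∈-map⁻ f (ys⊆f[xs] y∈ys)
    ... | z , z∈xs , refl with ∈-insert⁻ xs₁ z∈xs
    ...   | inj₁ refl   = subst (_∈ map f rest) (sym fx≡fx′) (∈-map⁺ f x′∈rest)
    ...   | inj₂ z∈rest = ∈-map⁺ f z∈rest
    shorter : length (map f rest) < length ys
    shorter = begin-strict
      length (map f rest)     ≡⟨ length-map f rest ⟩
      length rest             <⟨ n<1+n _ ⟩
      suc (length rest)       ≡⟨ length-++-sucʳ xs₁ x xs₂ ⟨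
      length (xs₁ ++ x ∷ xs₂) ≤⟨ |xs|≤|ys| ⟩
      length ys               ∎

length-cartesianProduct : ∀ {X Y : Set} (xs : List X) (ys : List Y) →
                          length (cartesianProduct xs ys) ≡ length xs * length ys
length-cartesianProduct []       ys = refl
length-cartesianProduct (x ∷ xs) ys = trans (length-++ (map (x ,_) ys))
  (cong₂ _+_ (length-map (x ,_) ys) (length-cartesianProduct xs ys))

module _ {X C : Set} {P : Pred X 0ℓ} {R : X → X → Set} (code : ∀ {x} → P x → C) where

  codes : ∀ {xs} → All P xs → List C
  codes []         = []
  codes (px ∷ pxs) = code px ∷ codes pxs

  length-codes : ∀ {xs} (pxs : All P xs) → length (codes pxs) ≡ length xs
  length-codes []        = refl
  length-codes (_ ∷ pxs) = cong suc (length-codes pxs)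

  codes-unique : (∀ {x y} (px : P x) (py : P y) → code px ≡ code py → ¬ R x y) →
                 ∀ {xs} (pxs : All P xs) → AllPairs R xs → Unique (codes pxs)
  codes-unique collision []         []         = []
  codes-unique collision (px ∷ pxs) (Rx ∷ Rxs) = apart pxs Rx ∷ codes-unique collision pxs Rxs
    where
    apart : ∀ {ys} (pys : All P ys) → All (R _) ys → All (code px ≢_) (codes pys)
    apart []         []           = []
    apart (py ∷ pys) (Rxy ∷ Rxys) = (λ eq → collision px py eq Rxy) ∷ apart pys Rxys

  length≤-by-codes : ∀ S → (∀ {x} (px : P x) → code px ∈ S) →
                     (∀ {x y} (px : P x) (py : P y) → code px ≡ code py → ¬ R x y) →
                     ∀ {xs} → All P xs → AllPairs R xs → length xs ≤ length S
  length≤-by-codes S code∈S collision pxs Rxs = subst (_≤ length S) (length-codes pxs)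
    (unique⇒length≤ (codes-unique collision pxs Rxs) (codes⊆S pxs))
    where
    codes⊆S : ∀ {xs} (pxs : All P xs) → codes pxs ⊆ S
    codes⊆S (px ∷ pxs) (here refl) = code∈S px
    codes⊆S (px ∷ pxs) (there c∈)  = codes⊆S pxs c∈

least-counterexample : ∀ {P : Pred ℕ 0ℓ} → Decidable P → ∀ m → ¬ P m →
                       ∃ λ k → ¬ P k × (∀ {j} → j < k → P j)
least-counterexample P? m ¬Pm with P? 0
... | no ¬P0 = 0 , ¬P0 , λ ()
least-counterexample P? zero ¬P0 | yes P0 = ⊥-elim (¬P0 P0)
least-counterexample {P} P? (suc m) ¬Pm | yes P0
  with least-counterexample {P ∘ suc} (P? ∘ suc) m ¬Pm
... | k , ¬Pk , below = suc k , ¬Pk , λ { {zero} _ → P0 ; {suc j} j<k → below (s≤s⁻¹ j<k) }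

module _ {k : ℕ} .{{_ : NonZero k}} where

  euclid : ∀ x → x ≡ x / k * k + x % k
  euclid x = trans (m≡m%n+[m/n]*n x k) (+-comm (x % k) _)

  euclid-unique : ∀ {x x′ r s} → k ∣ x → k ∣ x′ → r < k → s < k → x + r ≡ x′ + s → x ≡ x′
  euclid-unique {x} {x′} {r} {s} k∣x k∣x′ r<k s<k x+r≡x′+s =
    +-cancelʳ-≡ r x x′ (trans x+r≡x′+s (cong (x′ +_) (sym r≡s)))
    where
    open ≡-Reasoning
    r≡s : r ≡ s
    r≡s = begin
      r            ≡⟨ m<n⇒m%n≡m r<k ⟨
      r % k        ≡⟨ %-remove-+ˡ r k∣x ⟨
      (x + r) % k  ≡⟨ cong (_% k) x+r≡x′+s ⟩
      (x′ + s) % k ≡⟨ %-remove-+ˡ s k∣x′ ⟩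
      s % k        ≡⟨ m<n⇒m%n≡m s<k ⟩
      s            ∎

  ∣-<⇒+≤ : ∀ {m n} → k ∣ m → k ∣ n → m < n → m + k ≤ n
  ∣-<⇒+≤ (divides i refl) (divides j refl) ik<jk =
    subst (_≤ j * k) (+-comm k (i * k)) (*-monoˡ-≤ k (*-cancelʳ-< k i j ik<jk))

-- Tilings of {0, …, n − 1}

record Tiling (n : ℕ) (A B : Pred ℕ 0ℓ) : Set where
  field
    A? : Decidable A
    B? : Decidable B
    0∈A : A 0
    0∈B : B 0
    cover : ∀ {z} → z < n → ∃₂ λ a b → A a × B b × z ≡ a + b
    sum<n : ∀ {a b} → A a → B b → a + b < n
    sum-injectiveˡ : ∀ {a b a′ b′} → A a → B b → A a′ → B b′ → a + b ≡ a′ + b′ → a ≡ a′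

  sum-injectiveʳ : ∀ {a b a′ b′} → A a → B b → A a′ → B b′ → a + b ≡ a′ + b′ → b ≡ b′
  sum-injectiveʳ {a} {b} {a′} {b′} Aa Bb Aa′ Bb′ a+b≡a′+b′ = +-cancelˡ-≡ a b b′
    (trans a+b≡a′+b′ (cong (_+ b′) (sym (sum-injectiveˡ Aa Bb Aa′ Bb′ a+b≡a′+b′))))

  0<n : 0 < n
  0<n = sum<n 0∈A 0∈B

  A-bounded : ∀ {a} → A a → a < n
  A-bounded {a} Aa = subst (_< n) (+-identityʳ a) (sum<n Aa 0∈B)

  B-bounded : ∀ {b} → B b → b < n
  B-bounded = sum<n 0∈A

swap : ∀ {n A B} → Tiling n A B → Tiling n B A
swap {n} T = record
  { A? = B?
  ; B? = A?
  ; 0∈A = 0∈B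
  ; 0∈B = 0∈A
  ; cover = λ z<n → let a , b , Aa , Bb , z≡a+b = cover z<n in
      b , a , Bb , Aa , trans z≡a+b (+-comm a b)
  ; sum<n = λ {b} {a} Bb Aa → subst (_< n) (+-comm a b) (sum<n Aa Bb)
  ; sum-injectiveˡ = λ {b} {a} {b′} {a′} Bb Aa Bb′ Aa′ b+a≡b′+a′ →
      sum-injectiveʳ Aa Bb Aa′ Bb′ (trans (+-comm a b) (trans b+a≡b′+a′ (+-comm b′ a′)))
  }
  where open Tiling T

module DeBruijn {n : ℕ} {A B : Pred ℕ 0ℓ} (T : Tiling n A B) (c : ℕ)
                (initial : ∀ {r} → r < 2 + c → B r) (k∉B : ¬ B (2 + c)) where

  open Tiling T

  k : ℕ
  k = 2 + c

  k≤n : k ≤ n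
  k≤n = ≮⇒≥ λ n<k → <-irrefl refl (B-bounded (initial n<k))

  k∈A : k < n → A k
  k∈A k<n with cover k<n
  ... | a , b , Aa , Bb , k≡a+b with a <? k
  ...   | no a≮k  = subst A (≤-antisym (subst (a ≤_) (sym k≡a+b) (m≤m+n a b)) (≮⇒≥ a≮k)) Aa
  ...   | yes a<k = ⊥-elim (k∉B (subst B (sym k≡b) Bb))
    where
    k≡b : k ≡ b
    k≡b = trans k≡a+b (cong (_+ b) (sum-injectiveˡ Aa 0∈B 0∈A (initial a<k) (+-identityʳ a)))

  Regular : Pred ℕ 0ℓ
  Regular y = (A y → k ∣ y) × (∀ {m r} → k ∣ m → r < k → y ≡ m + r → B y ⇔ B m)

  module InsideBlock {y m r : ℕ} (ih : ∀ {y′} → y′ < y → Regular y′) (y<n : y < n)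
                     (k∣m : k ∣ m) (0<r : 0 < r) (r<k : r < k) (y≡m+r : y ≡ m + r) where

    m<y : m < y
    m<y = subst (m <_) (sym y≡m+r) (m<m+n m 0<r)

    lower-split : B m ⊎ ∃₂ λ a b → A a × B b × 0 < a × a < y × a + b ≡ y
    lower-split with cover (<-trans m<y y<n)
    ... | a , b , Aa , Bb , m≡a+b with a ≟ 0
    ...   | yes refl = inj₁ (subst B (sym m≡a+b) Bb)
    ...   | no a≢0   = inj₂ (a , b + r , Aa , B[b+r] , n≢0⇒n>0 a≢0 , a<y , a+[b+r]≡y)
      where
      open ≡-Reasoning
      a+[b+r]≡y : a + (b + r) ≡ y
      a+[b+r]≡y = begin
        a + (b + r) ≡⟨ +-assoc a b r ⟨
        a + b + r   ≡⟨ cong (_+ r) m≡a+b ⟨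
        m + r       ≡⟨ y≡m+r ⟨
        y           ∎
      a<y : a < y
      a<y = ≤-<-trans (subst (a ≤_) (sym m≡a+b) (m≤m+n a b)) m<y
      b+r<y : b + r < y
      b+r<y = subst (b + r <_) a+[b+r]≡y (m<n+m (b + r) (n≢0⇒n>0 a≢0))
      k∣b : k ∣ b
      k∣b = ∣m+n∣m⇒∣n (subst (k ∣_) m≡a+b k∣m) (proj₁ (ih a<y) Aa)
      B[b+r] : B (b + r)
      B[b+r] = from (proj₂ (ih b+r<y) k∣b r<k refl) Bb

    y∉A : ¬ A y
    y∉A Ay with lower-split
    ... | inj₂ (a , b , Aa , Bb , _ , a<y , a+b≡y) =
      <-irrefl (sum-injectiveˡ Aa Bb Ay 0∈B (trans a+b≡y (sym (+-identityʳ y)))) a<y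
    ... | inj₁ Bm with m ≟ 0
    ...   | yes refl = >⇒≢ 0<r (trans (sym y≡m+r) y≡0)
      where
      y≡0 : y ≡ 0
      y≡0 = sum-injectiveˡ Ay 0∈B 0∈A (initial (subst (_< k) (sym y≡m+r) r<k)) (+-identityʳ y)
    ...   | no m≢0 = <-irrefl (sym y≡k) k<y
      where
      open ≡-Reasoning
      k<y : k < y
      k<y = ≤-<-trans (∣⇒≤ {{≢-nonZero m≢0}} k∣m) m<y
      y≡k : y ≡ k
      y≡k = sum-injectiveˡ Ay (initial (∸-monoʳ-< 0<r (<⇒≤ r<k))) (k∈A (<-trans k<y y<n)) Bm (begin
        y + (k ∸ r)       ≡⟨ cong (_+ (k ∸ r)) y≡m+r ⟩
        m + r + (k ∸ r)   ≡⟨ +-assoc m r (k ∸ r) ⟩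
        m + (r + (k ∸ r)) ≡⟨ cong (m +_) (m+[n∸m]≡n (<⇒≤ r<k)) ⟩
        m + k             ≡⟨ +-comm m k ⟩
        k + m             ∎)

    B-down : B y → B m
    B-down By with lower-split
    ... | inj₁ Bm = Bm
    ... | inj₂ (a , b , Aa , Bb , 0<a , _ , a+b≡y) =
      ⊥-elim (>⇒≢ 0<a (sum-injectiveˡ Aa Bb 0∈A By a+b≡y))

    B-up : B m → B y
    B-up Bm with cover y<n
    ... | a , b , Aa , Bb , y≡a+b with a ≟ 0
    ...   | yes refl = subst B (sym y≡a+b) Bb
    ...   | no a≢0 with a ≟ y
    ...     | yes refl = ⊥-elim (y∉A Aa)
    ...     | no a≢y   = ⊥-elim (a≢0 (sum-injectiveˡ Aa Bm′ 0∈A Bm a+m′≡m))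
      where
      open ≡-Reasoning
      a<y : a < y
      a<y = ≤∧≢⇒< (subst (a ≤_) (sym y≡a+b) (m≤m+n a b)) a≢y
      b<y : b < y
      b<y = subst (b <_) (sym y≡a+b) (m<n+m b (n≢0⇒n>0 a≢0))
      m′ : ℕ
      m′ = b / k * k
      k∣m′ : k ∣ m′
      k∣m′ = divides (b / k) refl
      Bm′ : B m′
      Bm′ = to (proj₂ (ih b<y) k∣m′ (m%n<n b k) (euclid b)) Bb
      a+m′≡m : a + m′ ≡ m
      a+m′≡m = euclid-unique (∣m∣n⇒∣m+n (proj₁ (ih a<y) Aa) k∣m′) k∣m (m%n<n b k) r<k (begin
        a + m′ + b % k   ≡⟨ +-assoc a m′ (b % k) ⟩
        a + (m′ + b % k) ≡⟨ cong (a +_) (euclid b) ⟨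
        a + b            ≡⟨ y≡a+b ⟨
        y                ≡⟨ y≡m+r ⟩
        m + r            ∎)

  regular : ∀ y → y < n → Regular y
  regular = <-rec (λ y → y < n → Regular y) λ y ih y<n →
    step y<n (λ y′<y → ih y′<y (<-trans y′<y y<n))
    where
    step : ∀ {y} → y < n → (∀ {y′} → y′ < y → Regular y′) → Regular y
    step {y} y<n ih = A-part , B-part
      where
      A-part : A y → k ∣ y
      A-part Ay with y % k ≟ 0
      ... | yes y%k≡0 = m%n≡0⇒n∣m y k y%k≡0
      ... | no y%k≢0  = ⊥-elim (InsideBlock.y∉A ih y<n (divides (y / k) refl)
                                  (n≢0⇒n>0 y%k≢0) (m%n<n y k) (euclid y) Ay)
      B-part : ∀ {m r} → k ∣ m → r < k → y ≡ m + r → B y ⇔ B m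
      B-part {m} {zero} _ _ y≡m+0 = mk⇔ (subst B y≡m) (subst B (sym y≡m))
        where y≡m = trans y≡m+0 (+-identityʳ m)
      B-part {m} {suc r} k∣m r<k y≡m+r = mk⇔ B-down B-up
        where open InsideBlock ih y<n k∣m (s≤s z≤n) r<k y≡m+r

  A⊆multiples : ∀ {x} → A x → k ∣ x
  A⊆multiples Ax = proj₁ (regular _ (A-bounded Ax)) Ax

  k∣n : k ∣ n
  k∣n with n % k ≟ 0
  ... | yes n%k≡0 = m%n≡0⇒n∣m n k n%k≡0
  ... | no n%k≢0  =
    ⊥-elim (no-partial-block (divides (n / k) refl) (n≢0⇒n>0 n%k≢0) (m%n<n n k) (euclid n))
    where
    no-partial-block : ∀ {m r} → k ∣ m → 0 < r → r < k → n ≢ m + r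
    no-partial-block {m} {r} k∣m 0<r r<k n≡m+r
      with cover (subst (m <_) (sym n≡m+r) (m<m+n m 0<r))
    ... | a , b , Aa , Bb , m≡a+b with a ≟ 0
    ...   | no a≢0 = <-irrefl a+[b+r]≡n (sum<n Aa B[b+r])
      where
      a+[b+r]≡n : a + (b + r) ≡ n
      a+[b+r]≡n = trans (sym (+-assoc a b r)) (trans (cong (_+ r) (sym m≡a+b)) (sym n≡m+r))
      b+r<n : b + r < n
      b+r<n = subst (b + r <_) a+[b+r]≡n (m<n+m (b + r) (n≢0⇒n>0 a≢0))
      k∣b : k ∣ b
      k∣b = ∣m+n∣m⇒∣n (subst (k ∣_) m≡a+b k∣m) (A⊆multiples Aa)
      B[b+r] : B (b + r)
      B[b+r] = from (proj₂ (regular (b + r) b+r<n) k∣b r<k refl) Bb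
    ...   | yes refl with m ≟ 0
    ...     | yes refl = <⇒≱ (subst (_< k) (sym n≡m+r) r<k) k≤n
    ...     | no m≢0   = <-asym (sum<n (k∈A k<n) (subst B (sym m≡a+b) Bb)) n<k+m
      where
      k<n : k < n
      k<n = ≤-<-trans (∣⇒≤ {{≢-nonZero m≢0}} k∣m) (subst (m <_) (sym n≡m+r) (m<m+n m 0<r))
      n<k+m : n < k + m
      n<k+m = subst₂ _<_ (sym n≡m+r) (+-comm m k) (+-monoʳ-< m r<k)

  B-blocks : ∀ {m r} → k ∣ m → r < k → B (m + r) ⇔ B m
  B-blocks {m} {r} k∣m r<k =
    mk⇔ (λ B[m+r] → to (block (B-bounded B[m+r])) B[m+r]) (λ Bm → from (block (m+r<n Bm)) Bm)
    where
    block : m + r < n → B (m + r) ⇔ B m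
    block m+r<n = proj₂ (regular (m + r) m+r<n) k∣m r<k refl
    m+r<n : B m → m + r < n
    m+r<n Bm = <-≤-trans (+-monoʳ-< m r<k) (∣-<⇒+≤ k∣m k∣n (B-bounded Bm))

  quotient : Tiling (n / k) (λ i → A (i * k)) (λ j → B (j * k))
  quotient = record
    { A? = λ i → A? (i * k)
    ; B? = λ j → B? (j * k)
    ; 0∈A = 0∈A
    ; 0∈B = 0∈B
    ; cover = cover′
    ; sum<n = λ {i} {j} Aik Bjk → *-cancelʳ-< k (i + j) (n / k)
        (subst₂ _<_ (sym (*-distribʳ-+ k i j)) (sym n/k*k≡n) (sum<n Aik Bjk))
    ; sum-injectiveˡ = λ {i} {j} {i′} {j′} Aik Bjk Ai′k Bj′k i+j≡i′+j′ →
        *-cancelʳ-≡ i i′ k (sum-injectiveˡ Aik Bjk Ai′k Bj′k (begin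
          i * k + j * k   ≡⟨ *-distribʳ-+ k i j ⟨
          (i + j) * k     ≡⟨ cong (_* k) i+j≡i′+j′ ⟩
          (i′ + j′) * k   ≡⟨ *-distribʳ-+ k i′ j′ ⟩
          i′ * k + j′ * k ∎))
    }
    where
    open ≡-Reasoning
    n/k*k≡n : n / k * k ≡ n
    n/k*k≡n = m/n*n≡m k∣n
    cover′ : ∀ {z} → z < n / k → ∃₂ λ i j → A (i * k) × B (j * k) × z ≡ i + j
    cover′ {z} z<n/k with cover (subst (z * k <_) n/k*k≡n (*-monoˡ-< k z<n/k))
    ... | a , b , Aa , Bb , zk≡a+b with A⊆multiples Aa
    ...   | divides i refl with ∣m+n∣m⇒∣n (subst (k ∣_) zk≡a+b (divides z refl)) (divides i refl)
    ...     | divides j refl =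
      i , j , Aa , Bb , *-cancelʳ-≡ z (i + j) k (trans zk≡a+b (sym (*-distribʳ-+ k i j)))

record Contraction (n : ℕ) (A B : Pred ℕ 0ℓ) : Set where
  field
    c : ℕ

  k : ℕ
  k = 2 + c

  field
    A⊆multiples : ∀ {x} → A x → k ∣ x
    B-blocks : ∀ {m r} → k ∣ m → r < k → B (m + r) ⇔ B m
    quotient : Tiling (n / k) (λ i → A (i * k)) (λ j → B (j * k))

  k≤n : k ≤ n
  k≤n = m/n≢0⇒n≤m (>⇒≢ (Tiling.0<n quotient))

  quotient<n : n / k < n
  quotient<n = m/n<m n k {{>-nonZero (<-≤-trans (s≤s z≤n) k≤n)}} (s≤s (s≤s z≤n))

contraction : ∀ {n A B} → Tiling n A B → B 1 → Contraction n A B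
contraction {n} {B = B} T B1
  with least-counterexample {B} (Tiling.B? T) n (λ Bn → <-irrefl refl (Tiling.B-bounded T Bn))
... | zero        , ¬B0 , _       = ⊥-elim (¬B0 (Tiling.0∈B T))
... | suc zero    , ¬B1 , _       = ⊥-elim (¬B1 B1)
... | suc (suc c) , k∉B , initial = record
  { c = c ; A⊆multiples = A⊆multiples ; B-blocks = B-blocks ; quotient = quotient }
  where open DeBruijn T c initial k∉B

-- Descriptors

Multiples : ℕ → Pred ℕ 0ℓ → Pred ℕ 0ℓ
Multiples k P x = ∃ λ i → x ≡ i * k × P i

Blocks : ℕ → Pred ℕ 0ℓ → Pred ℕ 0ℓ
Blocks k P x = ∃₂ λ j r → r < k × x ≡ j * k + r × P j

-- An entry (true , c) records a contraction with block length 2 + c of a tiling with 1 ∈ B,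
-- an entry (false , c) one of the swapped tiling, in which 1 ∈ A.
Descriptor : Set
Descriptor = List (Bool × ℕ)

⟦_⟧ᴬ : Descriptor → Pred ℕ 0ℓ
⟦ [] ⟧ᴬ              = _≡ 0
⟦ (true  , c) ∷ d ⟧ᴬ = Multiples (2 + c) ⟦ d ⟧ᴬ
⟦ (false , c) ∷ d ⟧ᴬ = Blocks (2 + c) ⟦ d ⟧ᴬ

⟦_⟧ᴮ : Descriptor → Pred ℕ 0ℓ
⟦ [] ⟧ᴮ              = _≡ 0
⟦ (true  , c) ∷ d ⟧ᴮ = Blocks (2 + c) ⟦ d ⟧ᴮ
⟦ (false , c) ∷ d ⟧ᴮ = Multiples (2 + c) ⟦ d ⟧ᴮ

Realizes : Descriptor → Pred ℕ 0ℓ → Pred ℕ 0ℓ → Set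
Realizes d A B = A ≐ ⟦ d ⟧ᴬ × B ≐ ⟦ d ⟧ᴮ

contraction-realizes : ∀ {n A B} (C : Contraction n A B) → let open Contraction C in
  ∀ {P Q} → (λ i → A (i * k)) ≐ P → (λ j → B (j * k)) ≐ Q → A ≐ Multiples k P × B ≐ Blocks k Q
contraction-realizes {A = A} {B} C (A⊆P , P⊆A) (B⊆Q , Q⊆B) =
  ( (λ Ax → let divides i x≡ik = A⊆multiples Ax in i , x≡ik , A⊆P (subst A x≡ik Ax))
  , (λ { (i , refl , Pi) → P⊆A Pi }) ) ,
  ( (λ {x} Bx → x / k , x % k , m%n<n x k , euclid x ,
       B⊆Q (to (B-blocks (divides (x / k) refl) (m%n<n x k)) (subst B (euclid x) Bx)))
  , (λ { (j , r , r<k , refl , Qj) → from (B-blocks (divides j refl) r<k) (Q⊆B Qj) }) )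
  where open Contraction C

extensions : (ℕ → List Descriptor) → ℕ → ℕ → List Descriptor
extensions ds n zero    = []
extensions ds n (suc c) =
  map ((true , c) ∷_) (ds (n / (2 + c))) ++ map ((false , c) ∷_) (ds (n / (2 + c))) ++
  extensions ds n c

descriptors : ℕ → ℕ → List Descriptor
descriptors zero    n = []
descriptors (suc f) n = [] ∷ extensions (descriptors f) n (pred n)

∈-extensions : ∀ ds n {c c′ d} b → c′ < c → d ∈ ds (n / (2 + c′)) →
               (b , c′) ∷ d ∈ extensions ds n c
∈-extensions ds n {suc c} b c′<1+c d∈ with m≤n⇒m<n∨m≡n (s≤s⁻¹ c′<1+c)
... | inj₁ c′<c = ∈-++⁺ʳ (map _ (ds (n / (2 + c)))) (∈-++⁺ʳ _ (∈-extensions ds n b c′<c d∈))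
∈-extensions ds n {suc c} true  _ d∈ | inj₂ refl = ∈-++⁺ˡ (∈-map⁺ _ d∈)
∈-extensions ds n {suc c} false _ d∈ | inj₂ refl =
  ∈-++⁺ʳ (map _ (ds (n / (2 + c)))) (∈-++⁺ˡ (∈-map⁺ _ d∈))

∈-descriptors : ∀ {f n c d} b → 2 + c ≤ n → d ∈ descriptors f (n / (2 + c)) →
                (b , c) ∷ d ∈ descriptors (suc f) n
∈-descriptors b k≤n d∈ = there (∈-extensions _ _ b (∸-monoˡ-≤ 1 k≤n) d∈)

realizes-[] : ∀ {n A B} → Tiling n A B → n ≤ 1 → Realizes [] A B
realizes-[] T n≤1 =
  ((λ Ax → n<1⇒n≡0 (<-≤-trans (A-bounded Ax) n≤1)) , λ { refl → 0∈A }) ,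
  ((λ Bx → n<1⇒n≡0 (<-≤-trans (B-bounded Bx) n≤1)) , λ { refl → 0∈B })
  where open Tiling T

realization : ∀ f {n A B} → n ≤ f → Tiling n A B →
              ∃ λ d → d ∈ descriptors f n × Realizes d A B
realization zero    n≤0 T = ⊥-elim (<⇒≱ (Tiling.0<n T) n≤0)
realization (suc f) {n} {A} {B} n≤1+f T with 1 <? n
... | no 1≮n  = [] , here refl , realizes-[] T (≮⇒≥ 1≮n)
... | yes 1<n = by-side-of-1 (Tiling.cover T 1<n)
  where
  fuel : ∀ {X Y} (C : Contraction n X Y) → n / Contraction.k C ≤ f
  fuel C = m<1+n⇒m≤n (<-≤-trans (Contraction.quotient<n C) n≤1+f)
  by-side-of-1 : (∃₂ λ a b → A a × B b × 1 ≡ a + b) →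
                 ∃ λ d → d ∈ descriptors (suc f) n × Realizes d A B
  by-side-of-1 (zero , _ , _ , B1 , refl) =
    let C = contraction T B1
        d , d∈ , A≐ , B≐ = realization f (fuel C) (Contraction.quotient C)
    in (true , Contraction.c C) ∷ d , ∈-descriptors true (Contraction.k≤n C) d∈ ,
       contraction-realizes C A≐ B≐
  by-side-of-1 (suc zero , _ , A1 , _ , refl) =
    let C = contraction (swap T) A1
        d , d∈ , A≐ , B≐ = realization f (fuel C) (swap (Contraction.quotient C))
        B≐′ , A≐′ = contraction-realizes C B≐ A≐
    in (false , Contraction.c C) ∷ d , ∈-descriptors false (Contraction.k≤n C) d∈ , A≐′ , B≐′
  by-side-of-1 (suc (suc _) , _ , _ , _ , ())

-- Counting descriptors

cube-distrib-* : ∀ m n → (m * n) ^ 3 ≡ m ^ 3 * n ^ 3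
cube-distrib-* = expanded
  where
  expanded : ∀ m n → m * n * (m * n * (m * n * 1)) ≡ m * (m * (m * 1)) * (n * (n * (n * 1)))
  expanded = solve-∀

-- The invariant says L ≤ (1 − 1 / M²) N; it survives adding 2t ≤ 2N / (M + 1)³ because
-- 2 / (M + 1)³ ≤ 1 / M² − 1 / (M + 1)².
cube-telescope : ∀ M N t L → 1 ≤ M → suc M ^ 3 * t ≤ N → N + M * M * L ≤ M * M * N →
                 N + suc M * suc M * (t + (t + L)) ≤ suc M * suc M * N
cube-telescope M N t L 1≤M S³t≤N ih =
  *-cancelˡ-≤ (M * M) {{>-nonZero (*-mono-≤ 1≤M 1≤M)}} (+-cancelʳ-≤ (S * S * N) _ _ (begin
    M * M * (N + S * S * (t + (t + L))) + S * S * N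
      ≡⟨ expand M N t L ⟩
    M * M * N + 2 * (M * M) * (S * S) * t + S * S * (N + M * M * L)
      ≤⟨ +-mono-≤ (+-monoʳ-≤ (M * M * N) middle) (*-monoʳ-≤ (S * S) ih) ⟩
    M * M * N + (2 * M + 1) * N + S * S * (M * M * N)
      ≡⟨ collect M N ⟩
    M * M * (S * S * N) + S * S * N ∎))
  where
  open ≤-Reasoning
  S = suc M
  expand : ∀ M N t L → M * M * (N + suc M * suc M * (t + (t + L))) + suc M * suc M * N
                     ≡ M * M * N + 2 * (M * M) * (suc M * suc M) * t
                       + suc M * suc M * (N + M * M * L)
  expand = solve-∀
  collect : ∀ M N → M * M * N + (2 * M + 1) * N + suc M * suc M * (M * M * N)
                  ≡ M * M * (suc M * suc M * N) + suc M * suc M * N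
  collect = solve-∀
  split : ∀ M t → 2 * (M * M) * (suc M * suc M) * t + (3 * M + 1) * (suc M * suc M) * t
                ≡ (2 * M + 1) * (suc M * (suc M * (suc M * 1)) * t)
  split = solve-∀
  middle : 2 * (M * M) * (S * S) * t ≤ (2 * M + 1) * N
  middle = begin
    2 * (M * M) * (S * S) * t                             ≤⟨ m≤m+n _ _ ⟩
    2 * (M * M) * (S * S) * t + (3 * M + 1) * (S * S) * t ≡⟨ split M t ⟩
    (2 * M + 1) * (S ^ 3 * t)                             ≤⟨ *-monoʳ-≤ (2 * M + 1) S³t≤N ⟩
    (2 * M + 1) * N                                       ∎

length-extensions : ∀ ds n c →
  (∀ {c′} → c′ < c → length (ds (n / (2 + c′))) ≤ (n / (2 + c′)) ^ 3) →
  n ^ 3 + suc c * suc c * length (extensions ds n c) ≤ suc c * suc c * n ^ 3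
length-extensions ds n zero    _     = ≤-refl
length-extensions ds n (suc c) bound = begin
  n ^ 3 + S * S * length (map ((true , c) ∷_) D ++ map ((false , c) ∷_) D ++ E)
    ≡⟨ cong (λ ℓ → n ^ 3 + S * S * ℓ) length-step ⟩
  n ^ 3 + S * S * (length D + (length D + length E))
    ≤⟨ +-monoʳ-≤ (n ^ 3) (*-monoʳ-≤ (S * S) (+-mono-≤ D≤t (+-monoˡ-≤ (length E) D≤t))) ⟩
  n ^ 3 + S * S * (t + (t + length E))
    ≤⟨ cube-telescope (suc c) (n ^ 3) t (length E) (s≤s z≤n) S³t≤n³
         (length-extensions ds n c (bound ∘ m<n⇒m<1+n)) ⟩
  S * S * n ^ 3 ∎
  where
  open ≤-Reasoning
  S = 2 + c
  D = ds (n / S)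
  E = extensions ds n c
  t = (n / S) ^ 3
  D≤t : length D ≤ t
  D≤t = bound ≤-refl
  length-step : length (map ((true , c) ∷_) D ++ map ((false , c) ∷_) D ++ E)
              ≡ length D + (length D + length E)
  length-step = trans (length-++ (map ((true , c) ∷_) D)) (cong₂ _+_ (length-map _ D)
    (trans (length-++ (map ((false , c) ∷_) D)) (cong (_+ length E) (length-map _ D))))
  S³t≤n³ : S ^ 3 * t ≤ n ^ 3
  S³t≤n³ = begin
    S ^ 3 * t         ≡⟨ cube-distrib-* S (n / S) ⟨
    (S * (n / S)) ^ 3 ≤⟨ ^-monoˡ-≤ 3 (subst (_≤ n) (*-comm (n / S) S) (m/n*n≤m n S)) ⟩
    n ^ 3             ∎

length-descriptors : ∀ f n → 1 ≤ n → length (descriptors f n) ≤ n ^ 3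
length-descriptors zero    n       _ = z≤n
length-descriptors (suc f) (suc m) _ = *-cancelˡ-≤ (n * n) (begin
  n * n * suc L     ≡⟨ *-suc (n * n) L ⟩
  n * n + n * n * L ≤⟨ +-monoˡ-≤ (n * n * L) (*-monoʳ-≤ n (m≤m*n n (n * 1))) ⟩
  n ^ 3 + n * n * L ≤⟨ length-extensions (descriptors f) n m bound ⟩
  n * n * n ^ 3     ∎)
  where
  open ≤-Reasoning
  n = suc m
  L = length (extensions (descriptors f) n m)
  bound : ∀ {c′} → c′ < m → length (descriptors f (n / (2 + c′))) ≤ (n / (2 + c′)) ^ 3
  bound c′<m = length-descriptors f _ (m≥n⇒m/n>0 (s≤s c′<m))

-- Tilings of [n] ⊂ ℤ

-- A ⊂ [1, n] is shifted down by one, so that A − 1 ⊕ B = {0, …, n − 1} with 0 ∈ A ∩ B.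
toℕᴬ : FinSubset → Pred ℕ 0ℓ
toℕᴬ As x = ℤ.+ suc x ∈ As

toℕᴮ : FinSubset → Pred ℕ 0ℓ
toℕᴮ Bs y = ℤ.+ y ∈ Bs

interval : ℕ → List ℤ
interval n = map (λ i → ℤ.+ suc i) (upTo n)

interval-unique : ∀ n → Unique (interval n)
interval-unique n = Unique.map⁺ (suc-injective ∘ ℤ.+-injective) (Unique.upTo⁺ n)

length-interval : ∀ n → length (interval n) ≡ n
length-interval n = trans (length-map _ (upTo n)) (length-upTo n)

interval⊆[n] : ∀ {n z} → z ∈ interval n → In[ n ] z
interval⊆[n] z∈ with ∈-map⁻ _ z∈
... | i , i∈ , refl = ℤ.+≤+ (s≤s z≤n) , ℤ.+≤+ (∈-upTo⁻ i∈)

module _ {α n : ℕ} {As Bs : FinSubset} (I : InT α n (As , Bs)) where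

  private
    sumset : SumsetIs[ n ] As Bs
    sumset = proj₁ (proj₂ (proj₂ I))

    n≡|As||Bs| : n ≡ length As * length Bs
    n≡|As||Bs| = proj₁ (proj₂ (proj₂ (proj₂ I)))

    0∈Bs : ℤ.+ 0 ∈ Bs
    0∈Bs = proj₁ (proj₂ (proj₂ (proj₂ (proj₂ (proj₂ I)))))

    Bs≥0 : All (ℤ.+ 0 ℤ.≤_) Bs
    Bs≥0 = proj₂ (proj₂ (proj₂ (proj₂ (proj₂ (proj₂ I)))))

  Bs-natural : ∀ {z} → z ∈ Bs → ∃ λ y → z ≡ ℤ.+ y
  Bs-natural z∈Bs with All.lookup Bs≥0 z∈Bs
  ... | ℤ.+≤+ {n = y} _ = y , refl

  As-positive : ∀ {z} → z ∈ As → ∃ λ x → z ≡ ℤ.+ suc x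
  As-positive {z} z∈As
    with proj₁ (proj₂ (sumset z) z (ℤ.+ 0) z∈As 0∈Bs (sym (ℤ.+-identityʳ z)))
  ... | ℤ.+≤+ {n = suc x} _ = x , refl

  -- |A| · |B| = n sums cover the n points of [n], so no two of them coincide.
  sum-injective : ∀ {a b a′ b′} → a ∈ As → b ∈ Bs → a′ ∈ As → b′ ∈ Bs →
                  a ℤ.+ b ≡ a′ ℤ.+ b′ → a ≡ a′
  sum-injective {a} {b} {a′} {b′} a∈ b∈ a′∈ b′∈ a+b≡a′+b′ with a ℤ.≟ a′
  ... | yes a≡a′ = a≡a′
  ... | no a≢a′  = ⊥-elim (pigeonhole (uncurry ℤ._+_) (interval-unique n) interval⊆sums
      |As×Bs|≤n (∈-cartesianProduct⁺ a∈ b∈) (∈-cartesianProduct⁺ a′∈ b′∈) (a≢a′ ∘ cong proj₁)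
      a+b≡a′+b′)
    where
    interval⊆sums : interval n ⊆ map (uncurry ℤ._+_) (cartesianProduct As Bs)
    interval⊆sums z∈ with proj₁ (sumset _) (interval⊆[n] z∈)
    ... | a , b , a∈ , b∈ , refl = ∈-map⁺ _ (∈-cartesianProduct⁺ a∈ b∈)
    |As×Bs|≤n : length (cartesianProduct As Bs) ≤ length (interval n)
    |As×Bs|≤n = ≤-reflexive (trans (length-cartesianProduct As Bs)
                                   (trans (sym n≡|As||Bs|) (sym (length-interval n))))

  tiling : 1 ≤ n → Tiling n (toℕᴬ As) (toℕᴮ Bs)
  tiling 1≤n = record
    { A? = λ x → ℤ.+ suc x ∈? As
    ; B? = λ y → ℤ.+ y ∈? Bs
    ; 0∈A = 0∈A
    ; 0∈B = 0∈Bs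
    ; cover = cover′
    ; sum<n = λ a∈ b∈ → ℤ.drop‿+≤+ (proj₂ (proj₂ (sumset _) _ _ a∈ b∈ refl))
    ; sum-injectiveˡ = λ a∈ b∈ a′∈ b′∈ a+b≡a′+b′ → suc-injective (ℤ.+-injective
        (sum-injective a∈ b∈ a′∈ b′∈ (cong (λ s → ℤ.+ suc s) a+b≡a′+b′)))
    }
    where
    cover′ : ∀ {z} → z < n → ∃₂ λ x y → toℕᴬ As x × toℕᴮ Bs y × z ≡ x + y
    cover′ z<n with proj₁ (sumset _) (ℤ.+≤+ (s≤s z≤n) , ℤ.+≤+ z<n)
    ... | a , b , a∈ , b∈ , z≡a+b with As-positive a∈ | Bs-natural b∈
    ...   | x , refl | y , refl = x , y , a∈ , b∈ , suc-injective (ℤ.+-injective z≡a+b)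
    0∈A : toℕᴬ As 0
    0∈A with cover′ 1≤n
    ... | x , y , x∈ , _ , 0≡x+y = subst (toℕᴬ As) (m+n≡0⇒m≡0 x (sym 0≡x+y)) x∈

  toℕᴬ-⊆ : ∀ {As′} → (∀ {x} → toℕᴬ As x → toℕᴬ As′ x) → ∀ {z} → z ∈ As → z ∈ As′
  toℕᴬ-⊆ A⊆A′ z∈ with As-positive z∈
  ... | _ , refl = A⊆A′ z∈

  toℕᴮ-⊆ : ∀ {Bs′} → (∀ {y} → toℕᴮ Bs y → toℕᴮ Bs′ y) → ∀ {z} → z ∈ Bs → z ∈ Bs′
  toℕᴮ-⊆ B⊆B′ z∈ with Bs-natural z∈
  ... | _ , refl = B⊆B′ z∈

same-realization⇒same-sets : ∀ {α n As Bs As′ Bs′ d} →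
  InT α n (As , Bs) → InT α n (As′ , Bs′) →
  Realizes d (toℕᴬ As) (toℕᴮ Bs) → Realizes d (toℕᴬ As′) (toℕᴮ Bs′) →
  SameSet As As′ × SameSet Bs Bs′
same-realization⇒same-sets I I′ (A≐ , B≐) (A′≐ , B′≐) =
  (λ _ → toℕᴬ-⊆ I (proj₂ A′≐ ∘ proj₁ A≐) , toℕᴬ-⊆ I′ (proj₂ A≐ ∘ proj₁ A′≐)) ,
  (λ _ → toℕᴮ-⊆ I (proj₂ B′≐ ∘ proj₁ B≐) , toℕᴮ-⊆ I′ (proj₂ B≐ ∘ proj₁ B′≐))

length-𝒯≤n³ : ∀ {α n} → 1 ≤ n → ∀ {Ps} → All (InT α n) Ps → AllPairs DistinctPairs Ps →
              length Ps ≤ n ^ 3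
length-𝒯≤n³ {α} {n} 1≤n Ps∈𝒯 distinct = ≤-trans
  (length≤-by-codes describe (descriptors n n) (proj₁ ∘ proj₂ ∘ realize) collision Ps∈𝒯 distinct)
  (length-descriptors n n 1≤n)
  where
  realize : ∀ {P} (I : InT α n P) →
            ∃ λ d → d ∈ descriptors n n × Realizes d (toℕᴬ (proj₁ P)) (toℕᴮ (proj₂ P))
  realize I = realization n ≤-refl (tiling I 1≤n)
  describe : ∀ {P} → InT α n P → Descriptor
  describe = proj₁ ∘ realize
  collision : ∀ {P Q} (I : InT α n P) (J : InT α n Q) → describe I ≡ describe J →
              ¬ DistinctPairs P Q
  collision I J d≡d′ distinct = distinct (same-realization⇒same-sets {d = describe I} I J
    (proj₂ (proj₂ (realize I)))
    (subst (λ d → Realizes d _ _) (sym d≡d′) (proj₂ (proj₂ (realize J)))))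

log₂-bracket : ∀ n → 1 ≤ n → ∃ λ w → 2 ^ w ≤ n × n < 2 ^ suc w
log₂-bracket (suc zero)    _ = 0 , ≤-refl , s≤s (s≤s z≤n)
log₂-bracket (suc (suc n)) _ with log₂-bracket (suc n) (s≤s z≤n)
... | w , 2^w≤1+n , 2+n≤2^[1+w] with m≤n⇒m<n∨m≡n 2+n≤2^[1+w]
...   | inj₁ 2+n<2^[1+w] = w , m≤n⇒m≤1+n 2^w≤1+n , 2+n<2^[1+w]
...   | inj₂ 2+n≡2^[1+w] = suc w , ≤-reflexive (sym 2+n≡2^[1+w]) ,
  subst (_< 2 ^ suc (suc w)) (sym 2+n≡2^[1+w]) (^-monoʳ-< 2 (s≤s (s≤s z≤n)) (n<1+n (suc w)))

ℓ*4+4≤2^ℓ : ∀ {ℓ} → 5 ≤ ℓ → ℓ * 4 + 4 ≤ 2 ^ ℓ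
ℓ*4+4≤2^ℓ {suc ℓ} 5≤1+ℓ with m≤n⇒m<n∨m≡n 5≤1+ℓ
... | inj₂ refl  = m≤m+n 24 8
... | inj₁ 5<1+ℓ = begin
  suc ℓ * 4 + 4 ≡⟨ cong (_+ 4) (+-comm 4 (ℓ * 4)) ⟩
  ℓ * 4 + 4 + 4 ≤⟨ +-mono-≤ ih (≤-trans (m≤n+m 4 (ℓ * 4)) ih) ⟩
  2 ^ ℓ + 2 ^ ℓ ≡⟨ cong (2 ^ ℓ +_) (+-identityʳ (2 ^ ℓ)) ⟨
  2 ^ suc ℓ     ∎
  where
  open ≤-Reasoning
  ih = ℓ*4+4≤2^ℓ (s≤s⁻¹ 5<1+ℓ)

exponent-inequality : ∀ p q w ℓ → 1 ≤ q → 4 ≤ w → ℓ * 4 ≤ w →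
                      q * (3 * suc w) * ℓ < (q + p) * w * w
exponent-inequality p q w ℓ 1≤q 4≤w ℓ*4≤w = begin-strict
  q * (3 * suc w) * ℓ ≡⟨ *-assoc q (3 * suc w) ℓ ⟩
  q * (3 * suc w * ℓ) <⟨ *-monoʳ-< q {{>-nonZero 1≤q}} (*-cancelˡ-< 4 _ _ 4X<4w²) ⟩
  q * (w * w)         ≤⟨ *-monoˡ-≤ (w * w) (m≤m+n q p) ⟩
  (q + p) * (w * w)   ≡⟨ *-assoc (q + p) w w ⟨
  (q + p) * w * w     ∎
  where
  open ≤-Reasoning
  3w<w² : 3 * w < w * w
  3w<w² = <-≤-trans (*-monoˡ-< w {{>-nonZero (≤-trans (s≤s z≤n) 4≤w)}} {3} {4} ≤-refl)
                    (*-monoˡ-≤ w 4≤w)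
  move-4 : ∀ w ℓ → 4 * (3 * suc w * ℓ) ≡ 3 * suc w * (ℓ * 4)
  move-4 = solve-∀
  expand : ∀ w → 3 * suc w * w ≡ 3 * (w * w) + 3 * w
  expand = solve-∀
  collect : ∀ w → 3 * (w * w) + w * w ≡ 4 * (w * w)
  collect = solve-∀
  4X<4w² : 4 * (3 * suc w * ℓ) < 4 * (w * w)
  4X<4w² = begin-strict
    4 * (3 * suc w * ℓ) ≡⟨ move-4 w ℓ ⟩
    3 * suc w * (ℓ * 4) ≤⟨ *-monoʳ-≤ (3 * suc w) ℓ*4≤w ⟩
    3 * suc w * w       ≡⟨ expand w ⟩
    3 * (w * w) + 3 * w <⟨ +-monoʳ-< (3 * (w * w)) 3w<w² ⟩
    3 * (w * w) + w * w ≡⟨ collect w ⟩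
    4 * (w * w)         ∎

-- D = 1 and w = ⌊log₂ n⌋; the crude bound ℓ = ⌊w / 4⌋ ≥ log₂ (w + 1) suffices because K ≤ n³.
cube-bound⇒BelowBound : ∀ p q {n K} → 1 ≤ q → 2 ^ 20 ≤ n → K ≤ n ^ 3 → BelowBound p q n K
cube-bound⇒BelowBound p q {n} {K} 1≤q 2²⁰≤n K≤n³ =
  1 , w , suc w , 3 * suc w , ℓ , s≤s z≤n ,
  subst (2 ^ w ≤_) (sym (*-identityʳ n)) 2^w≤n ,
  subst (_≤ 2 ^ suc w) (sym (*-identityʳ n)) (<⇒≤ n<2^[1+w]) ,
  subst (_≤ 2 ^ (3 * suc w)) (sym (*-identityʳ K)) K≤2^[3[1+w]] ,
  subst₂ _≤_ (sym (*-identityʳ (suc w))) (sym (*-identityʳ (2 ^ ℓ))) 1+w≤2^ℓ ,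
  exponent-inequality p q w ℓ 1≤q (≤-trans (m≤m+n 4 16) 20≤w) (m/n*n≤m w 4)
  where
  open ≤-Reasoning
  bracket = log₂-bracket n (≤-trans (m^n>0 2 20) 2²⁰≤n)
  w = proj₁ bracket
  2^w≤n = proj₁ (proj₂ bracket)
  n<2^[1+w] = proj₂ (proj₂ bracket)
  ℓ = w / 4
  20≤w : 20 ≤ w
  20≤w = ≮⇒≥ λ w<20 → <⇒≱ (<-≤-trans n<2^[1+w] (^-monoʳ-≤ 2 w<20)) 2²⁰≤n
  1+w≤2^ℓ : suc w ≤ 2 ^ ℓ
  1+w≤2^ℓ = begin
    suc w               ≡⟨ cong suc (euclid w) ⟩
    suc (ℓ * 4 + w % 4) ≤⟨ +-monoʳ-< (ℓ * 4) (m%n<n w 4) ⟩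
    ℓ * 4 + 4           ≤⟨ ℓ*4+4≤2^ℓ (/-monoˡ-≤ 4 20≤w) ⟩
    2 ^ ℓ               ∎
  K≤2^[3[1+w]] : K ≤ 2 ^ (3 * suc w)
  K≤2^[3[1+w]] = begin
    K               ≤⟨ K≤n³ ⟩
    n ^ 3           ≤⟨ ^-monoˡ-≤ 3 (<⇒≤ n<2^[1+w]) ⟩
    (2 ^ suc w) ^ 3 ≡⟨ ^-*-assoc 2 (suc w) 3 ⟩
    2 ^ (suc w * 3) ≡⟨ cong (2 ^_) (*-comm (suc w) 3) ⟩
    2 ^ (3 * suc w) ∎

corollary2 : (p q : ℕ) → p ≥ 1 → q ≥ 1 →
    Σ ℕ λ N → (n : ℕ) → n ≥ N →
      (α : ℕ) → α ≥ 1 →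
      (Ps : List (FinSubset × FinSubset)) →
      All (InT α n) Ps → AllPairs DistinctPairs Ps →
      BelowBound p q n (length Ps)
corollary2 p q _ q≥1 = 2 ^ 20 , λ n n≥2²⁰ _ _ _ Ps∈𝒯 distinct →
  cube-bound⇒BelowBound p q q≥1 n≥2²⁰ (length-𝒯≤n³ (≤-trans (m^n>0 2 20) n≥2²⁰) Ps∈𝒯 distinct)
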